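{- Let $p$ be an odd prime and $\mathbf{n}\in\mathbb{Q}_p^3\setminus\{\mathbf{0}\}$. Let $A,A'\in G_x$, $B,B'\in G_y$, and $N,N'\in SO(3)_p$ with $N\mathbf{n}=\mathbf{n}$ and $N'\mathbf{n}=\mathbf{n}$. If $ABN=A'B'N'$ and $(A,B,N)\neq(A',B',N')$, then $N\neq N'$.
   Context: For $p$ odd, fix a unit $u\in\mathbb{Z}_p^\times$ that is not a square in $\mathbb{Q}_p$, and set $v=-u$ if $p\equiv 1 \pmod 4$, $v=-1$ if $p\equiv 3\pmod 4$. Let $A_+=\mathrm{diag}(1,-v,p)$ and $SO(3)_p=\{L\in M_{3\times 3}(\mathbb{Q}_p): L^\top A_+ L=A_+,\ \det L=1\}$. With canonical basis $\mathbf{e}_1,\mathbf{e}_2,\mathbf{e}_3$, $G_x=\{L\in SO(3)_p: L\mathbf{e}_1=\mathbf{e}_1\}$ and $G_y=\{L\in SO(3)_p: L\mathbf{e}_2=\mathbf{e}_2\}$. -}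

module Defs where

open import Data.Nat as ℕ using (ℕ; zero; suc; _%_; _^_)
open import Data.Integer as ℤ using (ℤ; +_)
open import Data.Integer.Divisibility using (_∣_)
open import Data.Fin using (Fin; zero; suc)
open import Data.Product using (Σ; _×_; _,_)
open import Relation.Binary.PropositionalEquality using (_≡_)
open import Relation.Nullary using (¬_; yes; no)

module Padic (p : ℕ) where

  pow : ℕ → ℤ
  pow n = + (p ^ n)

  -- ℤ_p : a p-adic integer is represented by a sequence a : ℕ → ℤ with
  -- a (n+1) ≡ a n (mod p^n)  (coherence); its value is lim a n.
  Zp : Set
  Zp = ℕ → ℤ

  CoherentZ : Zp → Set
  CoherentZ a = ∀ n → pow n ∣ (a (suc n) ℤ.- a n)

  _≈Z_ : Zp → Zp → Set
  a ≈Z b = ∀ n → pow n ∣ (a n ℤ.- b n)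

  record Qp : Set where
    constructor _/p^_
    field
      num : Zp
      exp : ℕ
  open Qp public

  CoherentQ : Qp → Set
  CoherentQ x = CoherentZ (num x)

  scale : ℤ → Zp → Zp
  scale c a n = c ℤ.* a n

  infix 4 _≈_
  _≈_ : Qp → Qp → Set
  x ≈ y = scale (pow (exp y)) (num x) ≈Z scale (pow (exp x)) (num y)

  infixl 6 _+_
  infixl 7 _*_
  _+_ : Qp → Qp → Qp
  x + y = (λ n → pow (exp y) ℤ.* num x n ℤ.+ pow (exp x) ℤ.* num y n) /p^ (exp x ℕ.+ exp y)

  _*_ : Qp → Qp → Qp
  x * y = (λ n → num x n ℤ.* num y n) /p^ (exp x ℕ.+ exp y)

  -_ : Qp → Qp
  - x = (λ n → ℤ.- num x n) /p^ exp x

  fromℤ : ℤ → Qp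
  fromℤ c = (λ _ → c) /p^ 0

  fromZp : Zp → Qp
  fromZp a = a /p^ 0

  0Q 1Q : Qp
  0Q = fromℤ (+ 0)
  1Q = fromℤ (+ 1)

  IsUnitZp : Zp → Set
  IsUnitZp u = CoherentZ u × ¬ (+ p ∣ u 1)

  NonSquare : Zp → Set
  NonSquare u = ¬ (Σ Qp (λ x → CoherentQ x × (x * x ≈ fromZp u)))

  vOf : Zp → Qp
  vOf u with p % 4 ℕ.≟ 1
  ... | yes _ = - fromZp u
  ... | no _  = - 1Q

  Vec3 : Set
  Vec3 = Fin 3 → Qp

  Mat3 : Set
  Mat3 = Fin 3 → Fin 3 → Qp

  infix 4 _≈V_ _≈M_
  infixl 7 _·_
  infixr 7 _▹_
  _≈V_ : Vec3 → Vec3 → Set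
  x ≈V y = ∀ i → x i ≈ y i

  _≈M_ : Mat3 → Mat3 → Set
  L ≈M M = ∀ i j → L i j ≈ M i j

  CoherentV : Vec3 → Set
  CoherentV x = ∀ i → CoherentQ (x i)

  CoherentM : Mat3 → Set
  CoherentM L = ∀ i j → CoherentQ (L i j)

  0V : Vec3
  0V _ = 0Q

  e₁ e₂ : Vec3
  e₁ zero = 1Q
  e₁ _ = 0Q
  e₂ (suc zero) = 1Q
  e₂ _ = 0Q

  sum3 : (Fin 3 → Qp) → Qp
  sum3 f = f zero + f (suc zero) + f (suc (suc zero))

  _·_ : Mat3 → Mat3 → Mat3
  (L · M) i j = sum3 (λ k → L i k * M k j)

  _▹_ : Mat3 → Vec3 → Vec3
  (L ▹ x) i = sum3 (λ k → L i k * x k)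

  transpose : Mat3 → Mat3
  transpose L i j = L j i

  det : Mat3 → Qp
  det L = (a * ((e * i) - (f * h)) + (- (b * ((d * i) - (f * g))))) + c * ((d * h) - (e * g))
    where
    _-_ : Qp → Qp → Qp
    x - y = x + - y
    a = L zero zero ; b = L zero (suc zero) ; c = L zero (suc (suc zero))
    d = L (suc zero) zero ; e = L (suc zero) (suc zero) ; f = L (suc zero) (suc (suc zero))
    g = L (suc (suc zero)) zero ; h = L (suc (suc zero)) (suc zero) ; i = L (suc (suc zero)) (suc (suc zero))

  Aplus : Zp → Mat3
  Aplus u zero zero = 1Q
  Aplus u (suc zero) (suc zero) = - vOf u
  Aplus u (suc (suc zero)) (suc (suc zero)) = fromℤ (+ p)
  Aplus u _ _ = 0Q

  SO3 : Zp → Mat3 → Set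
  SO3 u L = CoherentM L × ((transpose L · Aplus u) · L ≈M Aplus u) × (det L ≈ 1Q)

  Gx : Zp → Mat3 → Set
  Gx u L = SO3 u L × ((L ▹ e₁) ≈V e₁)

  Gy : Zp → Mat3 → Set
  Gy u L = SO3 u L × ((L ▹ e₂) ≈V e₂)

{-# OPTIONS --safe #-}
module Submission where

-- Suppose A B N = A′ B′ N′ with N = N′. Then C = A′⁻¹ A = B′ B⁻¹ fixes e₁ (as A and A′ do) and
-- e₂ (as B and B′ do), preserves the form A₊ and has determinant 1. As A₊ = diag(1, -v, p) with
-- 1 and -v units, comparing the first two rows of Cᵀ A₊ C = A₊ forces the third column of C to
-- be (0, 0, c), and then det C = c = 1. So C = I, that is A = A′ and B = B′.

open import Algebra using (CommutativeRing; RawRing; Monoid)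
open import Data.Nat using (ℕ; NonZero)
open import Data.Integer using (ℤ)
open import Data.Nat.Primality using (Prime)
open import Defs

-- The library's non-reflective ring solver takes its coefficients from the ring itself, where it
-- cannot detect cancellations such as 1 - 1 = 0; here coefficients are integers.
module DifferenceCoefficientSolver {c ℓ} (R : CommutativeRing c ℓ) where
  open import Data.Bool using (Bool; true; false)
  open import Data.Maybe using (nothing)
  open import Data.Nat as ℕ using (zero; suc; _∸_)
  open import Data.Product using (_,_) renaming (_×_ to _×ₚ_)
  open import Data.Vec using (Vec)
  open import Level using (0ℓ)
  open import Relation.Binary.PropositionalEquality using (_≡_)
  open CommutativeRing R hiding (zero)
  open import Algebra.Properties.AbelianGroup +-abelianGroup using (⁻¹-anti-homo‿-; ⁻¹-∙-comm)
  open import Algebra.Properties.CommutativeSemigroup +-commutativeSemigroup using (interchange)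
  open import Algebra.Properties.Ring ring using ([y-z]x≈yx-zx; x[y-z]≈xy-xz; -0#≈0#)
  open import Algebra.Properties.Semiring.Mult semiring using (_×_; ×-homo-+; ×1-homo-*)
  open import Algebra.Properties.Semiring.Exp.TCOptimised semiring using (^-congˡ)
  open import Relation.Binary.Reasoning.Setoid setoid
  open import Tactic.RingSolver.Core.AlmostCommutativeRing
    using (AlmostCommutativeRing; fromCommutativeRing; _-Raw-AlmostCommutative⟶_)
  open import Tactic.RingSolver.Core.Polynomial.Parameters using (Homomorphism)
  open import Tactic.RingSolver.Core.Expression public using (Expr; Κ; Ι; _⊕_; _⊗_; _⊛_; ⊝_; module Eval)

  Difference : Set
  Difference = ℕ ×ₚ ℕ

  -- (m , n) stands for m - n; keeping one component zero makes normal forms canonical.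
  difference : ℕ → ℕ → Difference
  difference m n = m ∸ n , n ∸ m

  differenceRawRing : RawRing 0ℓ 0ℓ
  differenceRawRing = record
    { Carrier = Difference
    ; _≈_ = _≡_
    ; _+_ = λ { (a , b) (x , y) → difference (a ℕ.+ x) (b ℕ.+ y) }
    ; _*_ = λ { (a , b) (x , y) → difference (a ℕ.* x ℕ.+ b ℕ.* y) (a ℕ.* y ℕ.+ b ℕ.* x) }
    ; -_ = λ { (a , b) → b , a }
    ; 0# = 0 , 0
    ; 1# = 1 , 0
    }

  ⟦_⟧ᶜ : Difference → Carrier
  ⟦ m , n ⟧ᶜ = m × 1# - n × 1#

  sub-cong : ∀ {u u′ v v′} → u ≈ u′ → v ≈ v′ → u - v ≈ u′ - v′
  sub-cong p q = +-cong p (-‿cong q)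

  sub-interchange : ∀ a b c d → (a + b) - (c + d) ≈ (a - c) + (b - d)
  sub-interchange a b c d = begin
    (a + b) - (c + d)     ≈⟨ +-congˡ (⁻¹-∙-comm c d) ⟨
    (a + b) + (- c + - d) ≈⟨ interchange a b (- c) (- d) ⟩
    (a - c) + (b - d)     ∎

  sub-cancelˡ : ∀ u x y → (u + x) - (u + y) ≈ x - y
  sub-cancelˡ u x y = begin
    (u + x) - (u + y)   ≈⟨ sub-interchange u x u y ⟩
    (u - u) + (x - y)   ≈⟨ +-congʳ (-‿inverseʳ u) ⟩
    0# + (x - y)        ≈⟨ +-identityˡ (x - y) ⟩
    x - y               ∎

  difference-correct : ∀ m n → ⟦ difference m n ⟧ᶜ ≈ ⟦ m , n ⟧ᶜ
  difference-correct zero    zero    = refl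
  difference-correct zero    (suc n) = refl
  difference-correct (suc m) zero    = refl
  difference-correct (suc m) (suc n) =
    trans (difference-correct m n) (sym (sub-cancelˡ 1# (m × 1#) (n × 1#)))

  difference-+-homo : ∀ a b x y → ⟦ difference (a ℕ.+ x) (b ℕ.+ y) ⟧ᶜ ≈ ⟦ a , b ⟧ᶜ + ⟦ x , y ⟧ᶜ
  difference-+-homo a b x y = begin
    ⟦ difference (a ℕ.+ x) (b ℕ.+ y) ⟧ᶜ    ≈⟨ difference-correct (a ℕ.+ x) (b ℕ.+ y) ⟩
    (a ℕ.+ x) × 1# - (b ℕ.+ y) × 1#         ≈⟨ sub-cong (×-homo-+ 1# a x) (×-homo-+ 1# b y) ⟩
    (a × 1# + x × 1#) - (b × 1# + y × 1#)   ≈⟨ sub-interchange _ _ _ _ ⟩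
    ⟦ a , b ⟧ᶜ + ⟦ x , y ⟧ᶜ                   ∎

  difference-*-homo : ∀ a b x y →
    ⟦ difference (a ℕ.* x ℕ.+ b ℕ.* y) (a ℕ.* y ℕ.+ b ℕ.* x) ⟧ᶜ ≈ ⟦ a , b ⟧ᶜ * ⟦ x , y ⟧ᶜ
  difference-*-homo a b x y = begin
    ⟦ difference (a ℕ.* x ℕ.+ b ℕ.* y) (a ℕ.* y ℕ.+ b ℕ.* x) ⟧ᶜ
      ≈⟨ difference-correct (a ℕ.* x ℕ.+ b ℕ.* y) (a ℕ.* y ℕ.+ b ℕ.* x) ⟩
    (a ℕ.* x ℕ.+ b ℕ.* y) × 1# - (a ℕ.* y ℕ.+ b ℕ.* x) × 1#
      ≈⟨ sub-cong (trans (×-homo-+ 1# (a ℕ.* x) (b ℕ.* y)) (+-cong (×1-homo-* a x) (×1-homo-* b y)))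
               (trans (×-homo-+ 1# (a ℕ.* y) (b ℕ.* x)) (+-cong (×1-homo-* a y) (×1-homo-* b x))) ⟩
    (A * X + B * Y) - (A * Y + B * X)
      ≈⟨ sub-interchange (A * X) (B * Y) (A * Y) (B * X) ⟩
    (A * X - A * Y) + (B * Y - B * X)
      ≈⟨ +-congˡ (⁻¹-anti-homo‿- (B * X) (B * Y)) ⟨
    (A * X - A * Y) - (B * X - B * Y)
      ≈⟨ sub-cong (x[y-z]≈xy-xz A X Y) (x[y-z]≈xy-xz B X Y) ⟨
    A * (X - Y) - B * (X - Y)
      ≈⟨ [y-z]x≈yx-zx (X - Y) A B ⟨
    (A - B) * (X - Y)
      ∎
    where
    A = a × 1#
    B = b × 1#
    X = x × 1#
    Y = y × 1#

  almostCommutativeRing : AlmostCommutativeRing c ℓ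
  almostCommutativeRing = fromCommutativeRing R (λ _ → nothing)

  embed : differenceRawRing -Raw-AlmostCommutative⟶ almostCommutativeRing
  embed = record
    { ⟦_⟧    = ⟦_⟧ᶜ
    ; +-homo = λ { (a , b) (x , y) → difference-+-homo a b x y }
    ; *-homo = λ { (a , b) (x , y) → difference-*-homo a b x y }
    ; -‿homo = λ { (a , b) → sym (⁻¹-anti-homo‿- (a × 1#) (b × 1#)) }
    ; 0-homo = -‿inverseʳ 0#
    ; 1-homo = trans (+-cong (+-identityʳ 1#) -0#≈0#) (+-identityʳ 1#)
    }

  isZero : Difference → Bool
  isZero (zero , zero) = true
  isZero _             = false

  homomorphism : Homomorphism 0ℓ 0ℓ c ℓ
  homomorphism = record
    { from          = record { rawRing = differenceRawRing ; isZero = isZero }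
    ; to            = almostCommutativeRing
    ; morphism      = embed
    ; Zero-C⟶Zero-R = λ { (zero , zero) _ → sym (-‿inverseʳ 0#) }
    }

  open Eval rawRing ⟦_⟧ᶜ public using (⟦_⟧)
  open import Tactic.RingSolver.Core.Polynomial.Base (Homomorphism.from homomorphism)
  open import Tactic.RingSolver.Core.Polynomial.Semantics homomorphism renaming (⟦_⟧ to ⟦_⟧ₚ)
  open import Tactic.RingSolver.Core.Polynomial.Homomorphism homomorphism

  normalise : ∀ {n} → Expr Difference n → Poly n
  normalise (Κ x)   = κ x
  normalise (Ι x)   = ι x
  normalise (x ⊕ y) = normalise x ⊞ normalise y
  normalise (x ⊗ y) = normalise x ⊠ normalise y
  normalise (⊝ x)   = ⊟ normalise x
  normalise (x ⊛ i) = normalise x ⊡ i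

  ⟦_⇓⟧ : ∀ {n} → Expr Difference n → Vec Carrier n → Carrier
  ⟦ e ⇓⟧ = ⟦ normalise e ⟧ₚ

  normalise-correct : ∀ {n} (e : Expr Difference n) ρ → ⟦ e ⇓⟧ ρ ≈ ⟦ e ⟧ ρ
  normalise-correct (Κ x)   ρ = κ-hom x ρ
  normalise-correct (Ι x)   ρ = ι-hom x ρ
  normalise-correct (x ⊕ y) ρ =
    trans (⊞-hom (normalise x) (normalise y) ρ) (+-cong (normalise-correct x ρ) (normalise-correct y ρ))
  normalise-correct (x ⊗ y) ρ =
    trans (⊠-hom (normalise x) (normalise y) ρ) (*-cong (normalise-correct x ρ) (normalise-correct y ρ))
  normalise-correct (⊝ x)   ρ = trans (⊟-hom (normalise x) ρ) (-‿cong (normalise-correct x ρ))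
  normalise-correct (x ⊛ i) ρ = trans (⊡-hom (normalise x) i ρ) (^-congˡ i (normalise-correct x ρ))

  open import Relation.Binary.Reflection setoid Ι ⟦_⟧ ⟦_⇓⟧ normalise-correct public using (prove)

module Matrix3 {c ℓ} (R : RawRing c ℓ) where
  open import Data.Fin using (Fin; zero; suc)
  open RawRing R

  infixl 6 _-_
  _-_ : Carrier → Carrier → Carrier
  x - y = x + - y

  sum3 : (Fin 3 → Carrier) → Carrier
  sum3 f = f zero + f (suc zero) + f (suc (suc zero))

  δ : ∀ {n} → Fin n → Fin n → Carrier
  δ zero    zero    = 1#
  δ (suc i) (suc j) = δ i j
  δ _       _       = 0#

  -- Without η-equality a product X · Y stays neutral until an entry is taken, so Agda can
  -- infer the factors of products in implicit arguments.
  record Matrix : Set c where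
    no-eta-equality
    field entry : Fin 3 → Fin 3 → Carrier
  open Matrix public

  infixl 7 _·_
  _·_ : Matrix → Matrix → Matrix
  entry (X · Y) i j = sum3 λ k → entry X i k * entry Y k j

  transpose : Matrix → Matrix
  entry (transpose X) i j = entry X j i

  I : Matrix
  entry I = δ

  det : Matrix → Carrier
  det X = a * (e * i - f * h) + - (b * (d * i - f * g)) + c′ * (d * h - e * g)
    where
    a = entry X zero zero ; b = entry X zero (suc zero) ; c′ = entry X zero (suc (suc zero))
    d = entry X (suc zero) zero ; e = entry X (suc zero) (suc zero) ; f = entry X (suc zero) (suc (suc zero))
    g = entry X (suc (suc zero)) zero ; h = entry X (suc (suc zero)) (suc zero) ; i = entry X (suc (suc zero)) (suc (suc zero))

  private
    _⁺ : Fin 3 → Fin 3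
    zero ⁺           = suc zero
    suc zero ⁺       = suc (suc zero)
    suc (suc zero) ⁺ = zero

  -- Indices of the cofactors are taken cyclically, which absorbs their signs.
  adj : Matrix → Matrix
  entry (adj X) i j =
    entry X (j ⁺) (i ⁺) * entry X (j ⁺ ⁺) (i ⁺ ⁺) - entry X (j ⁺) (i ⁺ ⁺) * entry X (j ⁺ ⁺) (i ⁺)

module Matrix3Properties {c ℓ} (R : CommutativeRing c ℓ) where
  open import Data.Empty using (⊥-elim)
  open import Data.Fin using (Fin; zero; suc; #_; combine; _↑ˡ_; _↑ʳ_)
  open import Data.Product using (_×_; _,_)
  open import Data.Vec using (Vec; tabulate; concat; _++_)
  open import Function using (_∘_)
  open import Level using (0ℓ; _⊔_)
  open import Relation.Binary.PropositionalEquality as ≡ using (_≡_; _≢_)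
  open import Relation.Binary.Structures using (IsEquivalence)
  open import Tactic.RingSolver.Core.AlmostCommutativeRing using (_-Raw-AlmostCommutative⟶_)
  open CommutativeRing R hiding (zero; _-_)
  import Relation.Binary.Reasoning.Setoid setoid as ≈-Reasoning
  open Matrix3 rawRing public
  open DifferenceCoefficientSolver R
    using (Difference; differenceRawRing; embed; Expr; Κ; Ι; _⊕_; _⊗_; ⊝_; ⟦_⟧; ⟦_⇓⟧; prove)

  infix 4 _≈ₘ_
  record _≈ₘ_ (X Y : Matrix) : Set ℓ where
    constructor pointwise
    field at : ∀ i j → entry X i j ≈ entry Y i j
  open _≈ₘ_ public

  ≈ₘ-isEquivalence : IsEquivalence _≈ₘ_
  ≈ₘ-isEquivalence = record
    { refl  = pointwise λ i j → refl
    ; sym   = λ e → pointwise λ i j → sym (at e i j)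
    ; trans = λ e e′ → pointwise λ i j → trans (at e i j) (at e′ i j)
    }

  sum3-cong : ∀ {f g} → (∀ k → f k ≈ g k) → sum3 f ≈ sum3 g
  sum3-cong e = +-cong (+-cong (e zero) (e (suc zero))) (e (suc (suc zero)))

  sum3-single : ∀ i {f} → (∀ k → k ≢ i → f k ≈ 0#) → sum3 f ≈ f i
  sum3-single zero h = begin
    _              ≈⟨ +-cong (+-congˡ (h (suc zero) λ ())) (h (suc (suc zero)) λ ()) ⟩
    _ + 0# + 0#    ≈⟨ trans (+-identityʳ _) (+-identityʳ _) ⟩
    _              ∎
    where open ≈-Reasoning
  sum3-single (suc zero) h = begin
    _              ≈⟨ +-cong (+-congʳ (h zero λ ())) (h (suc (suc zero)) λ ()) ⟩
    0# + _ + 0#    ≈⟨ trans (+-identityʳ _) (+-identityˡ _) ⟩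
    _              ∎
    where open ≈-Reasoning
  sum3-single (suc (suc zero)) h = begin
    _              ≈⟨ +-congʳ (+-cong (h zero λ ()) (h (suc zero) λ ())) ⟩
    0# + 0# + _    ≈⟨ trans (+-congʳ (+-identityʳ 0#)) (+-identityˡ _) ⟩
    _              ∎
    where open ≈-Reasoning

  δ-diagonal : ∀ {n} (i : Fin n) → δ i i ≡ 1#
  δ-diagonal zero    = ≡.refl
  δ-diagonal (suc i) = δ-diagonal i

  δ-offDiagonal : ∀ {n} {i j : Fin n} → i ≢ j → δ i j ≡ 0#
  δ-offDiagonal {i = zero}  {zero}  i≢j = ⊥-elim (i≢j ≡.refl)
  δ-offDiagonal {i = zero}  {suc j} i≢j = ≡.refl
  δ-offDiagonal {i = suc i} {zero}  i≢j = ≡.refl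
  δ-offDiagonal {i = suc i} {suc j} i≢j = δ-offDiagonal (i≢j ∘ ≡.cong suc)

  δ-symmetric : ∀ {n} (i j : Fin n) → δ i j ≡ δ j i
  δ-symmetric zero    zero    = ≡.refl
  δ-symmetric zero    (suc j) = ≡.refl
  δ-symmetric (suc i) zero    = ≡.refl
  δ-symmetric (suc i) (suc j) = δ-symmetric i j

  sum3-δˡ : ∀ i (f : Fin 3 → Carrier) → sum3 (λ k → δ i k * f k) ≈ f i
  sum3-δˡ i f = begin
    sum3 (λ k → δ i k * f k) ≈⟨ sum3-single i off-diagonal ⟩
    δ i i * f i              ≈⟨ *-congʳ (reflexive (δ-diagonal i)) ⟩
    1# * f i                 ≈⟨ *-identityˡ (f i) ⟩
    f i                      ∎
    where
    open ≈-Reasoning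
    off-diagonal : ∀ k → k ≢ i → δ i k * f k ≈ 0#
    off-diagonal k k≢i = trans (*-congʳ (reflexive (δ-offDiagonal (k≢i ∘ ≡.sym)))) (zeroˡ (f k))

  sum3-δʳ : ∀ j (f : Fin 3 → Carrier) → sum3 (λ k → f k * δ k j) ≈ f j
  sum3-δʳ j f = trans (sum3-cong λ k → trans (*-comm (f k) (δ k j)) (*-congʳ (reflexive (δ-symmetric k j))))
                      (sum3-δˡ j f)

  ·-cong : ∀ {X X′ Y Y′} → X ≈ₘ X′ → Y ≈ₘ Y′ → X · Y ≈ₘ X′ · Y′
  ·-cong eX eY = pointwise λ i j → sum3-cong λ k → *-cong (at eX i k) (at eY k j)

  ·-identityˡ : ∀ X → I · X ≈ₘ X
  ·-identityˡ X = pointwise λ i j → sum3-δˡ i (λ k → entry X k j)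

  ·-identityʳ : ∀ X → X · I ≈ₘ X
  ·-identityʳ X = pointwise λ i j → sum3-δʳ j (entry X i)

  transpose-cong : ∀ {X Y} → X ≈ₘ Y → transpose X ≈ₘ transpose Y
  transpose-cong e = pointwise λ i j → at e j i

  transpose-· : ∀ X Y → transpose (X · Y) ≈ₘ transpose Y · transpose X
  transpose-· X Y = pointwise λ i j → sum3-cong λ k → *-comm (entry X j k) (entry Y k i)

  transpose-I : transpose I ≈ₘ I
  transpose-I = pointwise λ i j → reflexive (δ-symmetric j i)

  exprRawRing : ℕ → RawRing 0ℓ 0ℓ
  exprRawRing n = record
    { Carrier = Expr Difference n ; _≈_ = _≡_ ; _+_ = _⊕_ ; _*_ = _⊗_ ; -_ = ⊝_
    ; 0# = Κ (RawRing.0# differenceRawRing) ; 1# = Κ (RawRing.1# differenceRawRing) }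

  module E {n} = Matrix3 (exprRawRing n)

  entries : Matrix → Vec Carrier 9
  entries X = concat (tabulate (tabulate ∘ entry X))

  -- A matrix of solver variables, whose value in the environment entries X is X itself at
  -- concrete indices; polynomial identities between entries are then checked by normalisation.
  var : ∀ {n} → (Fin 9 → Fin n) → E.Matrix {n}
  E.entry (var v) i j = Ι (v (combine i j))

  ·-assoc : ∀ X Y Z → (X · Y) · Z ≈ₘ X · (Y · Z)
  ·-assoc X Y Z = pointwise λ i j →
    prove (tabulate (entry X i) ++ entries Y ++ tabulate (λ k → entry Z k j))
      (E.sum3 λ k → E.sum3 (λ l → x′ l ⊗ E.entry Y′ l k) ⊗ z′ k)
      (E.sum3 λ l → x′ l ⊗ E.sum3 (λ k → E.entry Y′ l k ⊗ z′ k)) refl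
    where
    x′ z′ : Fin 3 → Expr Difference 15
    x′ l = Ι (l ↑ˡ 12)
    z′ k = Ι (3 ↑ʳ 9 ↑ʳ k)
    Y′ : E.Matrix {15}
    Y′ = var (λ k → 3 ↑ʳ (k ↑ˡ 3))

  ·-monoid : Monoid c ℓ
  ·-monoid = record
    { _≈_ = _≈ₘ_
    ; _∙_ = _·_
    ; ε   = I
    ; isMonoid = record
      { isSemigroup = record
        { isMagma = record { isEquivalence = ≈ₘ-isEquivalence ; ∙-cong = ·-cong }
        ; assoc   = ·-assoc
        }
      ; identity = ·-identityˡ , ·-identityʳ
      }
    }

  det-· : ∀ X Y → det (X · Y) ≈ det X * det Y
  det-· X Y = prove (entries X ++ entries Y) (E.det (X′ E.· Y′)) (E.det X′ ⊗ E.det Y′) refl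
    where
    X′ Y′ : E.Matrix {18}
    X′ = var (_↑ˡ 9)
    Y′ = var (9 ↑ʳ_)

  private
    X′ : E.Matrix {9}
    X′ = var (λ k → k)

  det-adj : ∀ X → det (adj X) ≈ det X * det X
  det-adj X = prove (entries X) (E.det (E.adj X′)) (E.det X′ ⊗ E.det X′) refl

  ⟦δ⟧ : ∀ {n m} (i j : Fin m) (ρ : Vec Carrier n) → ⟦ E.δ i j ⟧ ρ ≈ δ i j
  ⟦δ⟧ zero    zero    ρ = _-Raw-AlmostCommutative⟶_.1-homo embed
  ⟦δ⟧ zero    (suc j) ρ = _-Raw-AlmostCommutative⟶_.0-homo embed
  ⟦δ⟧ (suc i) zero    ρ = _-Raw-AlmostCommutative⟶_.0-homo embed
  ⟦δ⟧ (suc i) (suc j) ρ = ⟦δ⟧ i j ρ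

  entrywise : {P : Fin 3 → Fin 3 → Set ℓ} →
    P (# 0) (# 0) → P (# 0) (# 1) → P (# 0) (# 2) →
    P (# 1) (# 0) → P (# 1) (# 1) → P (# 1) (# 2) →
    P (# 2) (# 0) → P (# 2) (# 1) → P (# 2) (# 2) →
    ∀ i j → P i j
  entrywise p₀₀ p₀₁ p₀₂ p₁₀ p₁₁ p₁₂ p₂₀ p₂₁ p₂₂ = λ where
    zero             zero             → p₀₀
    zero             (suc zero)       → p₀₁
    zero             (suc (suc zero)) → p₀₂
    (suc zero)       zero             → p₁₀
    (suc zero)       (suc zero)       → p₁₁
    (suc zero)       (suc (suc zero)) → p₁₂
    (suc (suc zero)) zero             → p₂₀
    (suc (suc zero)) (suc zero)       → p₂₁
    (suc (suc zero)) (suc (suc zero)) → p₂₂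

  private
    det·δ-byNormalisation : ∀ X (L : E.Matrix {9}) i j →
      ⟦ E.entry L i j ⇓⟧ (entries X) ≈ ⟦ E.det X′ ⊗ E.δ i j ⇓⟧ (entries X) →
      ⟦ E.entry L i j ⟧ (entries X) ≈ det X * δ i j
    det·δ-byNormalisation X L i j nf =
      trans (prove (entries X) (E.entry L i j) (E.det X′ ⊗ E.δ i j) nf) (*-congˡ (⟦δ⟧ i j (entries X)))

  ·-adj : ∀ X i j → entry (X · adj X) i j ≈ det X * δ i j
  ·-adj X = entrywise (by (# 0) (# 0) refl) (by (# 0) (# 1) refl) (by (# 0) (# 2) refl)
                      (by (# 1) (# 0) refl) (by (# 1) (# 1) refl) (by (# 1) (# 2) refl)
                      (by (# 2) (# 0) refl) (by (# 2) (# 1) refl) (by (# 2) (# 2) refl)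
    where by = det·δ-byNormalisation X (X′ E.· E.adj X′)

  adj-· : ∀ X i j → entry (adj X · X) i j ≈ det X * δ i j
  adj-· X = entrywise (by (# 0) (# 0) refl) (by (# 0) (# 1) refl) (by (# 0) (# 2) refl)
                      (by (# 1) (# 0) refl) (by (# 1) (# 1) refl) (by (# 1) (# 2) refl)
                      (by (# 2) (# 0) refl) (by (# 2) (# 1) refl) (by (# 2) (# 2) refl)
    where by = det·δ-byNormalisation X (E.adj X′ E.· X′)

  ·-adj≈I : ∀ X → det X ≈ 1# → X · adj X ≈ₘ I
  ·-adj≈I X det≈1 = pointwise λ i j → trans (·-adj X i j) (trans (*-congʳ det≈1) (*-identityˡ (δ i j)))

  adj-·≈I : ∀ X → det X ≈ 1# → adj X · X ≈ₘ I
  adj-·≈I X det≈1 = pointwise λ i j → trans (adj-· X i j) (trans (*-congʳ det≈1) (*-identityˡ (δ i j)))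

  det-adj≈1 : ∀ X → det X ≈ 1# → det (adj X) ≈ 1#
  det-adj≈1 X det≈1 = trans (det-adj X) (trans (*-cong det≈1 det≈1) (*-identityˡ 1#))

  record FixesBasis (X : Matrix) (j : Fin 3) : Set ℓ where
    constructor fixesBasis
    field column : ∀ i → entry X i j ≈ δ i j
  open FixesBasis public

  ·-fixesBasis : ∀ X {Y j} → FixesBasis Y j → ∀ i → entry (X · Y) i j ≈ entry X i j
  ·-fixesBasis X {Y} {j} fixY i = trans (sum3-cong λ k → *-congˡ {entry X i k} (column fixY k)) (sum3-δʳ j (entry X i))

  fixesBasis-· : ∀ {X Y j} → FixesBasis X j → FixesBasis Y j → FixesBasis (X · Y) j
  fixesBasis-· {X} fixX fixY = fixesBasis λ i → trans (·-fixesBasis X fixY i) (column fixX i)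

  fixesBasis-inverse : ∀ {X Y j} → Y · X ≈ₘ I → FixesBasis X j → FixesBasis Y j
  fixesBasis-inverse {X} {Y} {j} YX≈I fixX = fixesBasis λ i → trans (sym (·-fixesBasis Y fixX i)) (at YX≈I i j)

  fixesBasis-cong : ∀ {X Y j} → X ≈ₘ Y → FixesBasis X j → FixesBasis Y j
  fixesBasis-cong {j = j} X≈Y fixX = fixesBasis λ i → trans (sym (at X≈Y i j)) (column fixX i)

  IsIsometry : Matrix → Matrix → Set ℓ
  IsIsometry D X = transpose X · D · X ≈ₘ D

  module _ where
    open Monoid ·-monoid using (∙-congˡ; ∙-congʳ; identityˡ; identityʳ)
      renaming (setoid to ≈ₘ-setoid; refl to ≈ₘ-refl)
    open import Algebra.Solver.Monoid ·-monoid using (solve; _⊜_) renaming (_⊕_ to _∙_)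
    open import Relation.Binary.Reasoning.Setoid ≈ₘ-setoid

    transpose-·-conjugate : ∀ D X Y → transpose (X · Y) · D · (X · Y) ≈ₘ transpose Y · (transpose X · D · X) · Y
    transpose-·-conjugate D X Y = begin
      transpose (X · Y) · D · (X · Y)             ≈⟨ ∙-congʳ (∙-congʳ (transpose-· X Y)) ⟩
      transpose Y · transpose X · D · (X · Y)     ≈⟨ reassociate (transpose Y) (transpose X) D X Y ⟩
      transpose Y · (transpose X · D · X) · Y     ∎
      where
      reassociate = solve 5 (λ a b c d e → ((a ∙ b) ∙ c) ∙ (d ∙ e) ⊜ (a ∙ ((b ∙ c) ∙ d)) ∙ e) ≈ₘ-refl

    isometry-· : ∀ {D X Y} → IsIsometry D X → IsIsometry D Y → IsIsometry D (X · Y)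
    isometry-· {D} {X} {Y} isoX isoY = begin
      transpose (X · Y) · D · (X · Y)             ≈⟨ transpose-·-conjugate D X Y ⟩
      transpose Y · (transpose X · D · X) · Y     ≈⟨ ∙-congʳ (∙-congˡ isoX) ⟩
      transpose Y · D · Y                         ≈⟨ isoY ⟩
      D                                           ∎

    isometry-inverse : ∀ {D X Y} → X · Y ≈ₘ I → IsIsometry D X → IsIsometry D Y
    isometry-inverse {D} {X} {Y} XY≈I isoX = begin
      transpose Y · D · Y                         ≈⟨ ∙-congʳ (∙-congˡ isoX) ⟨
      transpose Y · (transpose X · D · X) · Y     ≈⟨ transpose-·-conjugate D X Y ⟨
      transpose (X · Y) · D · (X · Y)             ≈⟨ ·-cong (∙-congʳ (transpose-cong XY≈I)) XY≈I ⟩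
      transpose I · D · I                         ≈⟨ ∙-congʳ (∙-congʳ transpose-I) ⟩
      I · D · I                                   ≈⟨ identityʳ (I · D) ⟩
      I · D                                       ≈⟨ identityˡ D ⟩
      D                                           ∎

  Diagonal : Matrix → Set ℓ
  Diagonal D = ∀ {i j} → i ≢ j → entry D i j ≈ 0#

  Regular : Carrier → Set (c ⊔ ℓ)
  Regular a = ∀ x → a * x ≈ 0# → x ≈ 0#

  transpose-fixesBasis-· : ∀ {C j} X → FixesBasis C j → ∀ k → entry (transpose C · X) j k ≈ entry X j k
  transpose-fixesBasis-· {C} {j} X fixC k =
    trans (sum3-cong λ m → *-congʳ {entry X m k} (trans (column fixC m) (reflexive (δ-symmetric m j))))
          (sum3-δˡ j λ m → entry X m k)

  diagonal-· : ∀ {D} X → Diagonal D → ∀ j k → entry (D · X) j k ≈ entry D j j * entry X j k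
  diagonal-· {D} X diagD j k = sum3-single j λ m m≢j → trans (*-congʳ (diagD (m≢j ∘ ≡.sym))) (zeroˡ (entry X m k))

  isometry-fixesBasis-row : ∀ {D C j} → Diagonal D → IsIsometry D C → FixesBasis C j →
    ∀ k → entry D j j * entry C j k ≈ entry D j k
  isometry-fixesBasis-row {D} {C} {j} diagD isoC fixC k = begin
    entry D j j * entry C j k          ≈⟨ diagonal-· {D} C diagD j k ⟨
    entry (D · C) j k                  ≈⟨ sum3-cong (λ l → *-congʳ {entry C l k} (transpose-fixesBasis-· D fixC l)) ⟨
    entry (transpose C · D · C) j k    ≈⟨ at isoC j k ⟩
    entry D j k                        ∎
    where open ≈-Reasoning

  det-fixesBasis₀₁ : ∀ {C} → FixesBasis C (# 0) → FixesBasis C (# 1) → det C ≈ entry C (# 2) (# 2)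
  det-fixesBasis₀₁ {C} fix₀ fix₁ = begin
    det C          ≈⟨ +-cong (+-cong term₀ term₁) term₂ ⟩
    i + 0# + 0#    ≈⟨ trans (+-identityʳ _) (+-identityʳ i) ⟩
    i              ∎
    where
    open ≈-Reasoning
    open import Algebra.Properties.Ring ring using (-0#≈0#)
    a = entry C (# 0) (# 0) ; b = entry C (# 0) (# 1) ; c′ = entry C (# 0) (# 2)
    d = entry C (# 1) (# 0) ; e = entry C (# 1) (# 1) ; f = entry C (# 1) (# 2)
    g = entry C (# 2) (# 0) ; h = entry C (# 2) (# 1) ; i = entry C (# 2) (# 2)
    h≈0 = column fix₁ (# 2)
    term₀ : a * (e * i - f * h) ≈ i
    term₀ = begin
      a * (e * i - f * h)  ≈⟨ *-cong (column fix₀ (# 0))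
                                      (+-cong (*-congʳ (column fix₁ (# 1))) (-‿cong (trans (*-congˡ h≈0) (zeroʳ f)))) ⟩
      1# * (1# * i - 0#)   ≈⟨ *-identityˡ _ ⟩
      1# * i - 0#          ≈⟨ +-cong (*-identityˡ i) -0#≈0# ⟩
      i + 0#               ≈⟨ +-identityʳ i ⟩
      i                    ∎
    term₁ : - (b * (d * i - f * g)) ≈ 0#
    term₁ = trans (-‿cong (trans (*-congʳ (column fix₁ (# 0))) (zeroˡ _))) -0#≈0#
    term₂ : c′ * (d * h - e * g) ≈ 0#
    term₂ = begin
      c′ * (d * h - e * g)   ≈⟨ *-congˡ (+-cong (*-congˡ h≈0) (-‿cong (*-congˡ (column fix₀ (# 2))))) ⟩
      c′ * (d * 0# - e * 0#) ≈⟨ *-congˡ (+-cong (zeroʳ d) (trans (-‿cong (zeroʳ e)) -0#≈0#)) ⟩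
      c′ * (0# + 0#)         ≈⟨ *-congˡ (+-identityʳ 0#) ⟩
      c′ * 0#                ≈⟨ zeroʳ c′ ⟩
      0#                     ∎

  isometry-fixesBasis₀₁≈I : ∀ {D C} → Diagonal D → Regular (entry D (# 0) (# 0)) → Regular (entry D (# 1) (# 1)) →
    IsIsometry D C → det C ≈ 1# → FixesBasis C (# 0) → FixesBasis C (# 1) → C ≈ₘ I
  isometry-fixesBasis₀₁≈I {D} {C} diagD reg₀ reg₁ isoC detC≈1 fix₀ fix₁ = pointwise λ where
    i zero                          → column fix₀ i
    i (suc zero)                    → column fix₁ i
    zero (suc (suc zero))           → reg₀ _ (trans (isometry-fixesBasis-row diagD isoC fix₀ (# 2)) (diagD λ ()))
    (suc zero) (suc (suc zero))     → reg₁ _ (trans (isometry-fixesBasis-row diagD isoC fix₁ (# 2)) (diagD λ ()))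
    (suc (suc zero)) (suc (suc zero)) → trans (sym (det-fixesBasis₀₁ fix₀ fix₁)) detC≈1

  module _ where
    open import Algebra.Properties.Monoid ·-monoid using (insertˡ; insertʳ; cancelʳ; cancelˡ)
    open Monoid ·-monoid using (∙-congˡ; ∙-congʳ; assoc; identityˡ; identityʳ)
      renaming (setoid to ≈ₘ-setoid; sym to ≈ₘ-sym)
    open import Relation.Binary.Reasoning.Setoid ≈ₘ-setoid

    factorisation-unique : ∀ {D} → Diagonal D → Regular (entry D (# 0) (# 0)) → Regular (entry D (# 1) (# 1)) →
      ∀ {A A′ B B′ N N′} →
      IsIsometry D A → det A ≈ 1# → FixesBasis A (# 0) →
      IsIsometry D A′ → det A′ ≈ 1# → FixesBasis A′ (# 0) →
      det B ≈ 1# → FixesBasis B (# 1) → FixesBasis B′ (# 1) →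
      det N ≈ 1# → N ≈ₘ N′ → A · B · N ≈ₘ A′ · B′ · N′ →
      A ≈ₘ A′ × B ≈ₘ B′
    factorisation-unique {D} diagD reg₀ reg₁ {A} {A′} {B} {B′} {N} {N′}
      isoA detA fixA isoA′ detA′ fixA′ detB fixB fixB′ detN N≈N′ ABN≈A′B′N′ = A≈A′ , B≈B′
      where
      AB≈A′B′ : A · B ≈ₘ A′ · B′
      AB≈A′B′ = begin
        A · B                    ≈⟨ insertʳ (·-adj≈I N detN) (A · B) ⟩
        A · B · N · adj N        ≈⟨ ∙-congʳ ABN≈A′B′N′ ⟩
        A′ · B′ · N′ · adj N     ≈⟨ ∙-congʳ (∙-congˡ (≈ₘ-sym N≈N′)) ⟩
        A′ · B′ · N · adj N      ≈⟨ cancelʳ (·-adj≈I N detN) (A′ · B′) ⟩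
        A′ · B′                  ∎
      C = adj A′ · A
      C≈B′adjB : C ≈ₘ B′ · adj B
      C≈B′adjB = begin
        adj A′ · A               ≈⟨ insertʳ (·-adj≈I B detB) (adj A′ · A) ⟩
        adj A′ · A · B · adj B   ≈⟨ ∙-congʳ (assoc (adj A′) A B) ⟩
        adj A′ · (A · B) · adj B ≈⟨ ∙-congʳ (∙-congˡ AB≈A′B′) ⟩
        adj A′ · (A′ · B′) · adj B ≈⟨ ∙-congʳ (cancelˡ (adj-·≈I A′ detA′) B′) ⟩
        B′ · adj B               ∎
      C≈I : C ≈ₘ I
      C≈I = isometry-fixesBasis₀₁≈I diagD reg₀ reg₁
        (isometry-· (isometry-inverse (·-adj≈I A′ detA′) isoA′) isoA)
        (trans (det-· (adj A′) A) (trans (*-cong (det-adj≈1 A′ detA′) detA) (*-identityˡ 1#)))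
        (fixesBasis-· (fixesBasis-inverse (adj-·≈I A′ detA′) fixA′) fixA)
        (fixesBasis-cong (≈ₘ-sym C≈B′adjB) (fixesBasis-· fixB′ (fixesBasis-inverse (adj-·≈I B detB) fixB)))
      A≈A′ : A ≈ₘ A′
      A≈A′ = begin
        A                        ≈⟨ insertˡ (·-adj≈I A′ detA′) A ⟩
        A′ · (adj A′ · A)        ≈⟨ ∙-congˡ C≈I ⟩
        A′ · I                   ≈⟨ identityʳ A′ ⟩
        A′                       ∎
      B≈B′ : B ≈ₘ B′
      B≈B′ = ≈ₘ-sym (begin
        B′                       ≈⟨ insertʳ (adj-·≈I B detB) B′ ⟩
        B′ · adj B · B           ≈⟨ ∙-congʳ C≈B′adjB ⟨
        C · B                    ≈⟨ ∙-congʳ C≈I ⟩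
        I · B                    ≈⟨ identityˡ B ⟩
        B                        ∎)

module NegligibleSequences (p : ℕ) where
  open import Data.Integer using (_+_; _*_; -_; 0ℤ)
  open import Data.Integer.Divisibility.Signed as ℤ∣ using ()
  open import Relation.Binary.PropositionalEquality as ≡ using (_≡_)
  open Padic p using (pow)

  Negligible : (ℕ → ℤ) → Set
  Negligible f = ∀ n → pow n ℤ∣.∣ f n

  negligible-≗ : ∀ {f g} → (∀ n → f n ≡ g n) → Negligible g → Negligible f
  negligible-≗ f≗g neg n = ≡.subst (pow n ℤ∣.∣_) (≡.sym (f≗g n)) (neg n)

  negligible-0 : Negligible (λ _ → 0ℤ)
  negligible-0 n = ℤ∣.divides 0ℤ ≡.refl

  negligible-neg : ∀ {f} → Negligible f → Negligible (λ n → - f n)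
  negligible-neg neg n = ℤ∣.∣m⇒∣-m (neg n)

  negligible-combination : ∀ {f₁ f₂} (g₁ g₂ : ℕ → ℤ) → Negligible f₁ → Negligible f₂ →
    Negligible (λ n → g₁ n * f₁ n + g₂ n * f₂ n)
  negligible-combination g₁ g₂ neg₁ neg₂ n =
    ℤ∣.∣m∣n⇒∣m+n (ℤ∣.∣n⇒∣m*n (g₁ n) (neg₁ n)) (ℤ∣.∣n⇒∣m*n (g₂ n) (neg₂ n))

module CoherentPadics (p : ℕ) .{{_ : NonZero p}} where
  import Algebra.Consequences.Setoid as Consequences
  open import Data.Integer as ℤ using (+_; 0ℤ)
  import Data.Integer.Properties as ℤP
  open import Data.Integer.Divisibility.Signed as ℤ∣ using (∣ᵤ⇒∣; ∣⇒∣ᵤ)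
  open import Data.Integer.Tactic.RingSolver using (solve-∀)
  open import Data.Nat as ℕ using (zero; suc)
  import Data.Nat.Properties as ℕP
  open import Data.Product using (Σ; _,_; proj₁; proj₂)
  open import Level using (0ℓ)
  open import Relation.Binary.PropositionalEquality as ≡ using (_≡_; cong; cong₂)
  open import Relation.Binary.Bundles using (Setoid)
  open import Relation.Binary.Structures using (IsEquivalence)
  open Padic p
  open NegligibleSequences p

  pow-+ : ∀ m n → pow (m ℕ.+ n) ≡ pow m ℤ.* pow n
  pow-+ m n = ≡.trans (cong +_ (ℕP.^-distribˡ-+-* p m n)) (ℤP.pos-* (p ℕ.^ m) (p ℕ.^ n))

  cross : Qp → Qp → ℕ → ℤ
  cross x y n = pow (exp y) ℤ.* num x n ℤ.- pow (exp x) ℤ.* num y n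

  ≈⇒negligible : ∀ x y → x ≈ y → Negligible (cross x y)
  ≈⇒negligible x y x≈y n = ∣ᵤ⇒∣ (x≈y n)

  negligible⇒≈ : ∀ x y → Negligible (cross x y) → x ≈ y
  negligible⇒≈ x y neg n = ∣⇒∣ᵤ (neg n)

  ≈-byCross : ∀ x y → (∀ n → cross x y n ≡ 0ℤ) → x ≈ y
  ≈-byCross x y cross≡0 = negligible⇒≈ x y (negligible-≗ cross≡0 negligible-0)

  Δ : (ℕ → ℤ) → ℕ → ℤ
  Δ a n = a (suc n) ℤ.- a n

  coherent⇒negligible : ∀ a → CoherentZ a → Negligible (Δ a)
  coherent⇒negligible a coh n = ∣ᵤ⇒∣ (coh n)

  negligible⇒coherent : ∀ a → Negligible (Δ a) → CoherentZ a
  negligible⇒coherent a neg n = ∣⇒∣ᵤ (neg n)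

  pow∣pow-+ : ∀ j n → pow n ℤ∣.∣ pow (j ℕ.+ n)
  pow∣pow-+ j n = ℤ∣.divides (pow j) (pow-+ j n)

  telescope : ∀ a → CoherentZ a → ∀ j n → pow n ℤ∣.∣ (a (j ℕ.+ n) ℤ.- a n)
  telescope a coh zero    n = ℤ∣.divides 0ℤ (ℤP.+-inverseʳ (a n))
  telescope a coh (suc j) n = ≡.subst (pow n ℤ∣.∣_) (≡.sym (split (a (suc j ℕ.+ n)) (a (j ℕ.+ n)) (a n)))
    (ℤ∣.∣m∣n⇒∣m+n (ℤ∣.∣-trans (pow∣pow-+ j n) (coherent⇒negligible a coh (j ℕ.+ n))) (telescope a coh j n))
    where
    split : ∀ u v w → u ℤ.- w ≡ (u ℤ.- v) ℤ.+ (v ℤ.- w)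
    split = solve-∀

  ≈-refl : ∀ x → x ≈ x
  ≈-refl x = ≈-byCross x x λ n → ℤP.+-inverseʳ (pow (exp x) ℤ.* num x n)

  ≈-sym : ∀ x y → x ≈ y → y ≈ x
  ≈-sym x y x≈y = negligible⇒≈ y x
    (negligible-≗ (λ n → flip (pow (exp y) ℤ.* num x n) (pow (exp x) ℤ.* num y n)) (negligible-neg (≈⇒negligible x y x≈y)))
    where
    flip : ∀ u v → v ℤ.- u ≡ ℤ.- (u ℤ.- v)
    flip = solve-∀

  ≈-trans : ∀ x y z → CoherentQ x → CoherentQ z → x ≈ y → y ≈ z → x ≈ z
  ≈-trans x y z cohx cohz x≈y y≈z = negligible⇒≈ x z λ n →
    ≡.subst (pow n ℤ∣.∣_) (≡.sym (shift A C (num x n) (num z n) (num x (m n)) (num z (m n))))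
      (ℤ∣.∣m∣n⇒∣m+n (cross-shifted n)
        (ℤ∣.∣m∣n⇒∣m+n (ℤ∣.∣m⇒∣-m (ℤ∣.∣n⇒∣m*n C (telescope (num x) cohx b n)))
                      (ℤ∣.∣n⇒∣m*n A (telescope (num z) cohz b n))))
    where
    b = exp y
    A = pow (exp x) ; B = pow b ; C = pow (exp z)
    m : ℕ → ℕ
    m n = b ℕ.+ n
    instance
      _ = ℕP.m^n≢0 p b
    factor : ∀ A B C u v w →
      B ℤ.* (C ℤ.* u ℤ.- A ℤ.* w) ≡ C ℤ.* (B ℤ.* u ℤ.- A ℤ.* v) ℤ.+ A ℤ.* (C ℤ.* v ℤ.- B ℤ.* w)
    factor = solve-∀
    -- At level b + n the factor p ^ b of the two cross differences can be cancelled.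
    cross-shifted : ∀ n → pow n ℤ∣.∣ cross x z (m n)
    cross-shifted n = ℤ∣.*-cancelˡ-∣ B
      (≡.subst₂ ℤ∣._∣_ (pow-+ b n) (≡.sym (factor A B C (num x (m n)) (num y (m n)) (num z (m n))))
      (negligible-combination (λ _ → C) (λ _ → A) (≈⇒negligible x y x≈y) (≈⇒negligible y z y≈z) (m n)))
    shift : ∀ A C xₙ zₙ xₘ zₘ →
      C ℤ.* xₙ ℤ.- A ℤ.* zₙ
        ≡ (C ℤ.* xₘ ℤ.- A ℤ.* zₘ) ℤ.+ (ℤ.- (C ℤ.* (xₘ ℤ.- xₙ)) ℤ.+ A ℤ.* (zₘ ℤ.- zₙ))
    shift = solve-∀

  +-cong : ∀ x x′ y y′ → x ≈ x′ → y ≈ y′ → x + y ≈ x′ + y′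
  +-cong x x′ y y′ x≈x′ y≈y′ = negligible⇒≈ (x + y) (x′ + y′) (negligible-≗ expand
    (negligible-combination (λ _ → B ℤ.* B′) (λ _ → A ℤ.* A′)
       (≈⇒negligible x x′ x≈x′) (≈⇒negligible y y′ y≈y′)))
    where
    A = pow (exp x) ; B = pow (exp y) ; A′ = pow (exp x′) ; B′ = pow (exp y′)
    identity : ∀ A B A′ B′ u v u′ v′ →
      (A′ ℤ.* B′) ℤ.* (B ℤ.* u ℤ.+ A ℤ.* v) ℤ.- (A ℤ.* B) ℤ.* (B′ ℤ.* u′ ℤ.+ A′ ℤ.* v′)
        ≡ (B ℤ.* B′) ℤ.* (A′ ℤ.* u ℤ.- A ℤ.* u′) ℤ.+ (A ℤ.* A′) ℤ.* (B′ ℤ.* v ℤ.- B ℤ.* v′)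
    identity = solve-∀
    expand : ∀ n → cross (x + y) (x′ + y′) n ≡ (B ℤ.* B′) ℤ.* cross x x′ n ℤ.+ (A ℤ.* A′) ℤ.* cross y y′ n
    expand n = ≡.trans
      (cong₂ (λ P Q → P ℤ.* (B ℤ.* num x n ℤ.+ A ℤ.* num y n) ℤ.- Q ℤ.* (B′ ℤ.* num x′ n ℤ.+ A′ ℤ.* num y′ n))
             (pow-+ (exp x′) (exp y′)) (pow-+ (exp x) (exp y)))
      (identity A B A′ B′ (num x n) (num y n) (num x′ n) (num y′ n))

  *-cong : ∀ x x′ y y′ → x ≈ x′ → y ≈ y′ → x * y ≈ x′ * y′
  *-cong x x′ y y′ x≈x′ y≈y′ = negligible⇒≈ (x * y) (x′ * y′) (negligible-≗ expand
    (negligible-combination (λ n → B′ ℤ.* num y n) (λ n → A ℤ.* num x′ n)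
       (≈⇒negligible x x′ x≈x′) (≈⇒negligible y y′ y≈y′)))
    where
    A = pow (exp x) ; B = pow (exp y) ; A′ = pow (exp x′) ; B′ = pow (exp y′)
    identity : ∀ A B A′ B′ u v u′ v′ →
      (A′ ℤ.* B′) ℤ.* (u ℤ.* v) ℤ.- (A ℤ.* B) ℤ.* (u′ ℤ.* v′)
        ≡ (B′ ℤ.* v) ℤ.* (A′ ℤ.* u ℤ.- A ℤ.* u′) ℤ.+ (A ℤ.* u′) ℤ.* (B′ ℤ.* v ℤ.- B ℤ.* v′)
    identity = solve-∀
    expand : ∀ n →
      cross (x * y) (x′ * y′) n ≡ (B′ ℤ.* num y n) ℤ.* cross x x′ n ℤ.+ (A ℤ.* num x′ n) ℤ.* cross y y′ n
    expand n = ≡.trans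
      (cong₂ (λ P Q → P ℤ.* (num x n ℤ.* num y n) ℤ.- Q ℤ.* (num x′ n ℤ.* num y′ n))
             (pow-+ (exp x′) (exp y′)) (pow-+ (exp x) (exp y)))
      (identity A B A′ B′ (num x n) (num y n) (num x′ n) (num y′ n))

  -‿cong : ∀ x x′ → x ≈ x′ → - x ≈ - x′
  -‿cong x x′ x≈x′ = negligible⇒≈ (- x) (- x′) (negligible-≗ expand (negligible-neg (≈⇒negligible x x′ x≈x′)))
    where
    identity : ∀ A A′ u u′ → A′ ℤ.* ℤ.- u ℤ.- A ℤ.* ℤ.- u′ ≡ ℤ.- (A′ ℤ.* u ℤ.- A ℤ.* u′)
    identity = solve-∀
    expand : ∀ n → cross (- x) (- x′) n ≡ ℤ.- cross x x′ n
    expand n = identity (pow (exp x)) (pow (exp x′)) (num x n) (num x′ n)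

  ≈-byExpNum : ∀ x y → exp x ≡ exp y → (∀ n → num x n ≡ num y n) → x ≈ y
  ≈-byExpNum x y exp≡ num≡ = ≈-byCross x y λ n →
    ≡.trans (cong₂ (λ P u → pow (exp y) ℤ.* u ℤ.- P ℤ.* num y n) (cong pow exp≡) (num≡ n))
            (ℤP.+-inverseʳ (pow (exp y) ℤ.* num y n))

  +-assoc : ∀ x y z → (x + y) + z ≈ x + (y + z)
  +-assoc x y z = ≈-byExpNum ((x + y) + z) (x + (y + z)) (ℕP.+-assoc (exp x) (exp y) (exp z)) λ n →
      generalise (num x n) (num y n) (num z n) (pow-+ (exp x) (exp y)) (pow-+ (exp y) (exp z))
    where
    A = pow (exp x) ; B = pow (exp y) ; C = pow (exp z)
    identity : ∀ A B C u v w →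
      C ℤ.* (B ℤ.* u ℤ.+ A ℤ.* v) ℤ.+ (A ℤ.* B) ℤ.* w ≡ (B ℤ.* C) ℤ.* u ℤ.+ A ℤ.* (C ℤ.* v ℤ.+ B ℤ.* w)
    identity = solve-∀
    generalise : ∀ {AB BC} u v w → AB ≡ A ℤ.* B → BC ≡ B ℤ.* C →
      C ℤ.* (B ℤ.* u ℤ.+ A ℤ.* v) ℤ.+ AB ℤ.* w ≡ BC ℤ.* u ℤ.+ A ℤ.* (C ℤ.* v ℤ.+ B ℤ.* w)
    generalise u v w ≡.refl ≡.refl = identity A B C u v w

  +-comm : ∀ x y → x + y ≈ y + x
  +-comm x y = ≈-byExpNum (x + y) (y + x) (ℕP.+-comm (exp x) (exp y)) λ n →
    ℤP.+-comm (pow (exp y) ℤ.* num x n) (pow (exp x) ℤ.* num y n)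

  +-identityˡ : ∀ x → 0Q + x ≈ x
  +-identityˡ x = ≈-byExpNum (0Q + x) x ≡.refl λ n →
    ≡.trans (cong₂ ℤ._+_ (ℤP.*-zeroʳ (pow (exp x))) (ℤP.*-identityˡ (num x n))) (ℤP.+-identityˡ (num x n))

  -‿inverseˡ : ∀ x → - x + x ≈ 0Q
  -‿inverseˡ x = ≈-byCross (- x + x) 0Q λ n → identity (pow (exp x)) (pow (exp x ℕ.+ exp x)) (num x n)
    where
    identity : ∀ A AA u → + 1 ℤ.* (A ℤ.* ℤ.- u ℤ.+ A ℤ.* u) ℤ.- AA ℤ.* 0ℤ ≡ 0ℤ
    identity = solve-∀

  *-assoc : ∀ x y z → (x * y) * z ≈ x * (y * z)
  *-assoc x y z = ≈-byExpNum ((x * y) * z) (x * (y * z)) (ℕP.+-assoc (exp x) (exp y) (exp z)) λ n →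
    ℤP.*-assoc (num x n) (num y n) (num z n)

  *-comm : ∀ x y → x * y ≈ y * x
  *-comm x y = ≈-byExpNum (x * y) (y * x) (ℕP.+-comm (exp x) (exp y)) λ n → ℤP.*-comm (num x n) (num y n)

  *-identityˡ : ∀ x → 1Q * x ≈ x
  *-identityˡ x = ≈-byExpNum (1Q * x) x ≡.refl λ n → ℤP.*-identityˡ (num x n)

  *-distribˡ-+ : ∀ x y z → x * (y + z) ≈ x * y + x * z
  *-distribˡ-+ x y z = ≈-byCross (x * (y + z)) (x * y + x * z) λ n →
      generalise (num x n) (num y n) (num z n)
        (≡.trans (pow-+ (exp x ℕ.+ exp y) (exp x ℕ.+ exp z)) (cong₂ ℤ._*_ (pow-+ (exp x) (exp y)) (pow-+ (exp x) (exp z))))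
        (≡.trans (pow-+ (exp x) (exp y ℕ.+ exp z)) (cong (A ℤ.*_) (pow-+ (exp y) (exp z))))
        (pow-+ (exp x) (exp z)) (pow-+ (exp x) (exp y))
    where
    A = pow (exp x) ; B = pow (exp y) ; C = pow (exp z)
    identity : ∀ A B C u v w →
      ((A ℤ.* B) ℤ.* (A ℤ.* C)) ℤ.* (u ℤ.* (C ℤ.* v ℤ.+ B ℤ.* w))
        ℤ.- (A ℤ.* (B ℤ.* C)) ℤ.* ((A ℤ.* C) ℤ.* (u ℤ.* v) ℤ.+ (A ℤ.* B) ℤ.* (u ℤ.* w)) ≡ 0ℤ
    identity = solve-∀
    generalise : ∀ {ABAC ABC AC AB} u v w → ABAC ≡ (A ℤ.* B) ℤ.* (A ℤ.* C) → ABC ≡ A ℤ.* (B ℤ.* C) →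
      AC ≡ A ℤ.* C → AB ≡ A ℤ.* B →
      ABAC ℤ.* (u ℤ.* (C ℤ.* v ℤ.+ B ℤ.* w)) ℤ.- ABC ℤ.* (AC ℤ.* (u ℤ.* v) ℤ.+ AB ℤ.* (u ℤ.* w)) ≡ 0ℤ
    generalise u v w ≡.refl ≡.refl ≡.refl ≡.refl = identity A B C u v w

  coherent-+ : ∀ x y → CoherentQ x → CoherentQ y → CoherentQ (x + y)
  coherent-+ x y cohx cohy = negligible⇒coherent (num (x + y)) (negligible-≗ expand
    (negligible-combination (λ _ → pow (exp y)) (λ _ → pow (exp x))
       (coherent⇒negligible (num x) cohx) (coherent⇒negligible (num y) cohy)))
    where
    identity : ∀ A B u u′ v v′ →
      (B ℤ.* u′ ℤ.+ A ℤ.* v′) ℤ.- (B ℤ.* u ℤ.+ A ℤ.* v) ≡ B ℤ.* (u′ ℤ.- u) ℤ.+ A ℤ.* (v′ ℤ.- v)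
    identity = solve-∀
    expand : ∀ n → Δ (num (x + y)) n ≡ pow (exp y) ℤ.* Δ (num x) n ℤ.+ pow (exp x) ℤ.* Δ (num y) n
    expand n = identity (pow (exp x)) (pow (exp y)) (num x n) (num x (suc n)) (num y n) (num y (suc n))

  coherent-* : ∀ x y → CoherentQ x → CoherentQ y → CoherentQ (x * y)
  coherent-* x y cohx cohy = negligible⇒coherent (num (x * y)) (negligible-≗ expand
    (negligible-combination (λ n → num x (suc n)) (num y)
       (coherent⇒negligible (num y) cohy) (coherent⇒negligible (num x) cohx)))
    where
    identity : ∀ u u′ v v′ → u′ ℤ.* v′ ℤ.- u ℤ.* v ≡ u′ ℤ.* (v′ ℤ.- v) ℤ.+ v ℤ.* (u′ ℤ.- u)
    identity = solve-∀
    expand : ∀ n → Δ (num (x * y)) n ≡ num x (suc n) ℤ.* Δ (num y) n ℤ.+ num y n ℤ.* Δ (num x) n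
    expand n = identity (num x n) (num x (suc n)) (num y n) (num y (suc n))

  coherent-neg : ∀ x → CoherentQ x → CoherentQ (- x)
  coherent-neg x cohx = negligible⇒coherent (num (- x))
    (negligible-≗ (λ n → identity (num x n) (num x (suc n))) (negligible-neg (coherent⇒negligible (num x) cohx)))
    where
    identity : ∀ u u′ → ℤ.- u′ ℤ.- ℤ.- u ≡ ℤ.- (u′ ℤ.- u)
    identity = solve-∀

  coherent-fromℤ : ∀ c → CoherentQ (fromℤ c)
  coherent-fromℤ c = negligible⇒coherent (num (fromℤ c)) (negligible-≗ (λ _ → ℤP.+-inverseʳ c) negligible-0)

  -- The equality of representatives is transitive only on coherent ones.
  ℚₚ : Set
  ℚₚ = Σ Qp CoherentQ

  infix 4 _≈ₚ_
  _≈ₚ_ : ℚₚ → ℚₚ → Set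
  x ≈ₚ y = proj₁ x ≈ proj₁ y

  infixl 6 _+ₚ_
  infixl 7 _*ₚ_
  _+ₚ_ _*ₚ_ : ℚₚ → ℚₚ → ℚₚ
  x +ₚ y = proj₁ x + proj₁ y , coherent-+ (proj₁ x) (proj₁ y) (proj₂ x) (proj₂ y)
  x *ₚ y = proj₁ x * proj₁ y , coherent-* (proj₁ x) (proj₁ y) (proj₂ x) (proj₂ y)

  -ₚ_ : ℚₚ → ℚₚ
  -ₚ x = - proj₁ x , coherent-neg (proj₁ x) (proj₂ x)

  0ₚ 1ₚ : ℚₚ
  0ₚ = 0Q , coherent-fromℤ 0ℤ
  1ₚ = 1Q , coherent-fromℤ (+ 1)

  ≈ₚ-isEquivalence : IsEquivalence _≈ₚ_
  ≈ₚ-isEquivalence = record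
    { refl  = λ {x} → ≈-refl (proj₁ x)
    ; sym   = λ {x} {y} → ≈-sym (proj₁ x) (proj₁ y)
    ; trans = λ {x} {y} {z} → ≈-trans (proj₁ x) (proj₁ y) (proj₁ z) (proj₂ x) (proj₂ z)
    }

  ℚₚ-setoid : Setoid 0ℓ 0ℓ
  ℚₚ-setoid = record { isEquivalence = ≈ₚ-isEquivalence }

  ℚₚ-commutativeRing : CommutativeRing 0ℓ 0ℓ
  ℚₚ-commutativeRing = record
    { Carrier = ℚₚ ; _≈_ = _≈ₚ_ ; _+_ = _+ₚ_ ; _*_ = _*ₚ_ ; -_ = -ₚ_ ; 0# = 0ₚ ; 1# = 1ₚ
    ; isCommutativeRing = record
      { isRing = record
        { +-isAbelianGroup = record
          { isGroup = record
            { isMonoid = record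
              { isSemigroup = record
                { isMagma = record { isEquivalence = ≈ₚ-isEquivalence ; ∙-cong = λ {x y u v} → +ₚ-cong {x} {y} {u} {v} }
                ; assoc   = λ x y z → +-assoc (proj₁ x) (proj₁ y) (proj₁ z)
                }
              ; identity = comm∧idˡ⇒id {_∙_ = _+ₚ_} +ₚ-comm {e = 0ₚ} λ x → +-identityˡ (proj₁ x)
              }
            ; inverse = comm∧invˡ⇒inv {_∙_ = _+ₚ_} {_⁻¹ = -ₚ_} {e = 0ₚ} +ₚ-comm λ x → -‿inverseˡ (proj₁ x)
            ; ⁻¹-cong = λ {x} {x′} → -‿cong (proj₁ x) (proj₁ x′)
            }
          ; comm = +ₚ-comm
          }
        ; *-cong     = λ {x y u v} → *ₚ-cong {x} {y} {u} {v}
        ; *-assoc    = λ x y z → *-assoc (proj₁ x) (proj₁ y) (proj₁ z)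
        ; *-identity = comm∧idˡ⇒id {_∙_ = _*ₚ_} *ₚ-comm {e = 1ₚ} λ x → *-identityˡ (proj₁ x)
        ; distrib    = comm∧distrˡ⇒distr {_∙_ = _*ₚ_} {_◦_ = _+ₚ_} (λ {x y u v} → +ₚ-cong {x} {y} {u} {v}) *ₚ-comm
                         λ x y z → *-distribˡ-+ (proj₁ x) (proj₁ y) (proj₁ z)
        }
      ; *-comm = *ₚ-comm
      }
    }
    where
    open Consequences ℚₚ-setoid
    +ₚ-cong : ∀ {x x′ y y′} → x ≈ₚ x′ → y ≈ₚ y′ → x +ₚ y ≈ₚ x′ +ₚ y′
    +ₚ-cong {x} {x′} {y} {y′} = +-cong (proj₁ x) (proj₁ x′) (proj₁ y) (proj₁ y′)
    *ₚ-cong : ∀ {x x′ y y′} → x ≈ₚ x′ → y ≈ₚ y′ → x *ₚ y ≈ₚ x′ *ₚ y′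
    *ₚ-cong {x} {x′} {y} {y′} = *-cong (proj₁ x) (proj₁ x′) (proj₁ y) (proj₁ y′)
    +ₚ-comm : ∀ x y → x +ₚ y ≈ₚ y +ₚ x
    +ₚ-comm x y = +-comm (proj₁ x) (proj₁ y)
    *ₚ-comm : ∀ x y → x *ₚ y ≈ₚ y *ₚ x
    *ₚ-comm x y = *-comm (proj₁ x) (proj₁ y)

module PadicUnits (p : ℕ) (p-prime : Prime p) where
  open import Data.Empty using (⊥-elim)
  open import Data.Integer as ℤ using (+_; 0ℤ)
  import Data.Integer.Properties as ℤP
  open import Data.Integer.Divisibility.Signed as ℤ∣ using (∣ᵤ⇒∣; ∣⇒∣ᵤ)
  open import Data.Integer.Tactic.RingSolver using (solve-∀)
  open import Data.Nat as ℕ using (zero; suc)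
  import Data.Nat.Divisibility as ℕ∣
  import Data.Nat.Properties as ℕP
  open import Data.Nat.Primality using (prime⇒nonZero; prime⇒nonTrivial; euclidsLemma)
  open import Data.Product using (_,_)
  open import Data.Sum using (_⊎_; inj₁; inj₂)
  open import Relation.Binary.PropositionalEquality as ≡ using (_≡_; cong)
  open import Relation.Nullary using (¬_; yes; no)
  open Padic p
  private instance
    p≢0 : NonZero p
    p≢0 = prime⇒nonZero p-prime
  open CoherentPadics p using (telescope)

  prime-power-cancel : ∀ n {w x} → ¬ p ℕ∣.∣ w → p ℕ.^ n ℕ∣.∣ w ℕ.* x → p ℕ.^ n ℕ∣.∣ x
  prime-power-cancel zero    {w} {x} p∤w _ = ℕ∣.1∣ x
  prime-power-cancel (suc n) {w} {x} p∤w pⁿ⁺¹∣wx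
    with euclidsLemma w x p-prime (ℕ∣.∣-trans (ℕ∣.m∣m*n (p ℕ.^ n)) pⁿ⁺¹∣wx)
  ... | inj₁ p∣w = ⊥-elim (p∤w p∣w)
  ... | inj₂ (ℕ∣.divides q ≡.refl) = ≡.subst (p ℕ.^ suc n ℕ∣.∣_) (ℕP.*-comm p q) (ℕ∣.*-monoʳ-∣ p pⁿ∣q)
    where
    pⁿ∣q : p ℕ.^ n ℕ∣.∣ q
    pⁿ∣q = prime-power-cancel n p∤w (ℕ∣.*-cancelˡ-∣ p
             (≡.subst (p ℕ.* p ℕ.^ n ℕ∣.∣_) (ℕP.*-comm (w ℕ.* q) p)
               (≡.subst (p ℕ.^ suc n ℕ∣.∣_) (≡.sym (ℕP.*-assoc w q p)) pⁿ⁺¹∣wx)))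

  -- The level-0 term is unconstrained: every integer vanishes modulo p ^ 0.
  UnitSequence : (ℕ → ℤ) → Set
  UnitSequence w = ∀ n → ¬ p ℕ∣.∣ ℤ.∣ w (suc n) ∣

  unitSequence-cancel : ∀ w → UnitSequence w → ∀ x → (w /p^ 0) * x ≈ 0Q → x ≈ 0Q
  unitSequence-cancel w unit x wx≈0 zero    = ℕ∣.1∣ _
  unitSequence-cancel w unit x wx≈0 (suc n) =
    ≡.subst (p ℕ.^ suc n ℕ∣.∣_) (≡.sym (cong ℤ.∣_∣ (drop-zero (pow (exp x)) (num x (suc n)))))
      (prime-power-cancel (suc n) (unit n)
        (≡.subst (p ℕ.^ suc n ℕ∣.∣_)
                 (≡.trans (cong ℤ.∣_∣ (drop-zero (pow (exp x)) (w (suc n) ℤ.* num x (suc n))))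
                          (ℤP.abs-* (w (suc n)) (num x (suc n))))
                 (wx≈0 (suc n))))
    where
    drop-zero : ∀ P u → + 1 ℤ.* u ℤ.- P ℤ.* 0ℤ ≡ u
    drop-zero = solve-∀

  isUnitZp⇒unitSequence : ∀ u → IsUnitZp u → UnitSequence u
  isUnitZp⇒unitSequence u (cohu , p∤u₁) n p∣uₙ₊₁ = p∤u₁ (∣⇒∣ᵤ p∣u₁)
    where
    p∣uₙ₊₁-u₁ : + p ℤ∣.∣ (u (suc n) ℤ.- u 1)
    p∣uₙ₊₁-u₁ = ≡.subst₂ (λ d m → d ℤ∣.∣ (u m ℤ.- u 1)) (cong +_ (ℕP.*-identityʳ p)) (ℕP.+-comm n 1)
                         (telescope u cohu n 1)
    cancel : ∀ a b → a ℤ.- (a ℤ.- b) ≡ b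
    cancel = solve-∀
    p∣u₁ : + p ℤ∣.∣ u 1
    p∣u₁ = ≡.subst (+ p ℤ∣.∣_) (cancel (u (suc n)) (u 1))
             (ℤ∣.∣m∣n⇒∣m-n (∣ᵤ⇒∣ {i = u (suc n)} p∣uₙ₊₁) p∣uₙ₊₁-u₁)

  vOf-cases : ∀ u → vOf u ≡ - fromZp u ⊎ vOf u ≡ - 1Q
  vOf-cases u with p ℕ.% 4 ℕ.≟ 1
  ... | yes _ = inj₁ ≡.refl
  ... | no _  = inj₂ ≡.refl

  -vOf-cancel : ∀ u → IsUnitZp u → ∀ x → - vOf u * x ≈ 0Q → x ≈ 0Q
  -vOf-cancel u isUnit x -vx≈0 with vOf-cases u
  ... | inj₁ v≡-u =
    unitSequence-cancel (λ n → ℤ.- ℤ.- u n) neg-neg-u-unit x (≡.subst (λ v → - v * x ≈ 0Q) v≡-u -vx≈0)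
    where
    neg-neg-u-unit : UnitSequence (λ n → ℤ.- ℤ.- u n)
    neg-neg-u-unit n rewrite ℤP.neg-involutive (u (suc n)) = isUnitZp⇒unitSequence u isUnit n
  ... | inj₂ v≡-1 = unitSequence-cancel (λ _ → + 1) 1-unit x (≡.subst (λ v → - v * x ≈ 0Q) v≡-1 -vx≈0)
    where
    1-unit : UnitSequence (λ _ → + 1)
    1-unit n p∣1 = ℕ.nonTrivial⇒≢1 {{prime⇒nonTrivial p-prime}} (ℕ∣.∣1⇒≡1 p∣1)

module FactorisationOverℚₚ (p : ℕ) (p-prime : Prime p) (u : ℕ → ℤ) (isUnit : Padic.IsUnitZp p u) where
  open import Data.Empty using (⊥-elim)
  open import Data.Fin using (zero; suc; #_)
  open import Data.Integer using (+_; 0ℤ)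
  open import Data.Nat.Primality using (prime⇒nonZero)
  open import Data.Product using (_×_; _,_; proj₁; proj₂)
  open import Data.Sum using (inj₁; inj₂)
  import Relation.Binary.PropositionalEquality as ≡
  open Padic
  private instance
    p≢0 = prime⇒nonZero p-prime
  open CoherentPadics p
  open PadicUnits p p-prime
  module M = Matrix3Properties ℚₚ-commutativeRing
  module R = CommutativeRing ℚₚ-commutativeRing
  open M using (entry; pointwise; at; fixesBasis)

  lift : (L : Mat3 p) → CoherentM p L → M.Matrix
  entry (lift L cohL) i j = L i j , cohL i j

  coherent-vOf : CoherentQ p (vOf p u)
  coherent-vOf with vOf-cases u
  ... | inj₁ v≡-u = ≡.subst (CoherentQ p) (≡.sym v≡-u) (coherent-neg (fromZp p u) (proj₁ isUnit))
  ... | inj₂ v≡-1 = ≡.subst (CoherentQ p) (≡.sym v≡-1) (coherent-neg (1Q p) (coherent-fromℤ (+ 1)))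

  coherent-Aplus : CoherentM p (Aplus p u)
  coherent-Aplus zero             zero             = coherent-fromℤ (+ 1)
  coherent-Aplus zero             (suc zero)       = coherent-fromℤ 0ℤ
  coherent-Aplus zero             (suc (suc zero)) = coherent-fromℤ 0ℤ
  coherent-Aplus (suc zero)       zero             = coherent-fromℤ 0ℤ
  coherent-Aplus (suc zero)       (suc zero)       = coherent-neg (vOf p u) coherent-vOf
  coherent-Aplus (suc zero)       (suc (suc zero)) = coherent-fromℤ 0ℤ
  coherent-Aplus (suc (suc zero)) zero             = coherent-fromℤ 0ℤ
  coherent-Aplus (suc (suc zero)) (suc zero)       = coherent-fromℤ 0ℤ
  coherent-Aplus (suc (suc zero)) (suc (suc zero)) = coherent-fromℤ (+ p)

  A₊ : M.Matrix
  A₊ = lift (Aplus p u) coherent-Aplus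

  A₊-diagonal : M.Diagonal A₊
  A₊-diagonal {zero}           {zero}           0≢0 = ⊥-elim (0≢0 ≡.refl)
  A₊-diagonal {zero}           {suc zero}       _   = ≈-refl (0Q p)
  A₊-diagonal {zero}           {suc (suc zero)} _   = ≈-refl (0Q p)
  A₊-diagonal {suc zero}       {zero}           _   = ≈-refl (0Q p)
  A₊-diagonal {suc zero}       {suc zero}       1≢1 = ⊥-elim (1≢1 ≡.refl)
  A₊-diagonal {suc zero}       {suc (suc zero)} _   = ≈-refl (0Q p)
  A₊-diagonal {suc (suc zero)} {zero}           _   = ≈-refl (0Q p)
  A₊-diagonal {suc (suc zero)} {suc zero}       _   = ≈-refl (0Q p)
  A₊-diagonal {suc (suc zero)} {suc (suc zero)} 2≢2 = ⊥-elim (2≢2 ≡.refl)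

  A₊-regular₀ : M.Regular (entry A₊ (# 0) (# 0))
  A₊-regular₀ x 1x≈0 = begin
    x           ≈⟨ R.*-identityˡ x ⟨
    R.1# R.* x  ≈⟨ 1x≈0 ⟩
    R.0#        ∎
    where open import Relation.Binary.Reasoning.Setoid R.setoid

  A₊-regular₁ : M.Regular (entry A₊ (# 1) (# 1))
  A₊-regular₁ x = -vOf-cancel u isUnit (proj₁ x)

  SO3⇒isometry : ∀ L (so : SO3 p u L) → M.IsIsometry A₊ (lift L (proj₁ so))
  SO3⇒isometry L so = pointwise (proj₁ (proj₂ so))

  fixes-e₁ : ∀ L cohL → _≈V_ p (_▹_ p L (e₁ p)) (e₁ p) → M.FixesBasis (lift L cohL) (# 0)
  fixes-e₁ L cohL fix = M.fixesBasis-cong (M.·-identityʳ (lift L cohL)) (fixesBasis λ where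
    zero             → fix zero
    (suc zero)       → fix (suc zero)
    (suc (suc zero)) → fix (suc (suc zero)))

  fixes-e₂ : ∀ L cohL → _≈V_ p (_▹_ p L (e₂ p)) (e₂ p) → M.FixesBasis (lift L cohL) (# 1)
  fixes-e₂ L cohL fix = M.fixesBasis-cong (M.·-identityʳ (lift L cohL)) (fixesBasis λ where
    zero             → fix zero
    (suc zero)       → fix (suc zero)
    (suc (suc zero)) → fix (suc (suc zero)))

  factorisation-unique : ∀ A A′ B B′ N N′ →
    Gx p u A → Gx p u A′ → Gy p u B → Gy p u B′ → SO3 p u N → SO3 p u N′ →
    _≈M_ p (_·_ p (_·_ p A B) N) (_·_ p (_·_ p A′ B′) N′) → _≈M_ p N N′ →
    _≈M_ p A A′ × _≈M_ p B B′
  factorisation-unique A A′ B B′ N N′ (soA , fixA) (soA′ , fixA′) (soB , fixB) (soB′ , fixB′) soN soN′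
                       ABN≈A′B′N′ N≈N′ =
    at (proj₁ unique) , at (proj₂ unique)
    where
    unique = M.factorisation-unique A₊-diagonal A₊-regular₀ A₊-regular₁
           {lift A (proj₁ soA)} {lift A′ (proj₁ soA′)} {lift B (proj₁ soB)} {lift B′ (proj₁ soB′)}
           {lift N (proj₁ soN)} {lift N′ (proj₁ soN′)}
           (SO3⇒isometry A soA) (proj₂ (proj₂ soA)) (fixes-e₁ A _ fixA)
           (SO3⇒isometry A′ soA′) (proj₂ (proj₂ soA′)) (fixes-e₁ A′ _ fixA′)
           (proj₂ (proj₂ soB)) (fixes-e₂ B _ fixB) (fixes-e₂ B′ _ fixB′)
           (proj₂ (proj₂ soN)) (pointwise N≈N′) (pointwise ABN≈A′B′N′)

open import Data.Product using (_×_)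
open import Relation.Binary.PropositionalEquality using (_≢_)
open import Relation.Nullary using (¬_)
open Padic

corollary3 : (p : ℕ) → Prime p → p ≢ 2 →
    (u : ℕ → ℤ) → IsUnitZp p u → NonSquare p u →
    (n : Vec3 p) → CoherentV p n → ¬ (_≈V_ p n (0V p)) →
    (A A' B B' N N' : Mat3 p) →
    Gx p u A → Gx p u A' → Gy p u B → Gy p u B' →
    SO3 p u N → SO3 p u N' →
    _≈V_ p (_▹_ p N n) n → _≈V_ p (_▹_ p N' n) n →
    _≈M_ p (_·_ p (_·_ p A B) N) (_·_ p (_·_ p A' B') N') →
    ¬ (_≈M_ p A A' × _≈M_ p B B' × _≈M_ p N N') →
    ¬ (_≈M_ p N N')
corollary3 p p-prime _ u isUnit _ _ _ _ A A' B B' N N' gA gA' gB gB' soN soN' _ _ ABN≈A'B'N' distinct N≈N' =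
  distinct (proj₁ AB≈A'B' , proj₂ AB≈A'B' , N≈N')
  where
  open import Data.Product using (_,_; proj₁; proj₂)
  open FactorisationOverℚₚ p p-prime u isUnit using (factorisation-unique)
  AB≈A'B' = factorisation-unique A A' B B' N N' gA gA' gB gB' soN soN' ABN≈A'B'N' N≈N'
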